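{- Let $n\geq 1$ be an integer, let $P_n=\langle a_0,\dots,a_k\rangle$ be the $n$-th $P$-sequence, and for each integer $s\geq 0$ let $F_{n,s}(x)=\sum_{i=0}^k a_i(i+x)^s$, a polynomial function over $\mathbb{R}$. Then for every integer $s\geq n$ the degree of $F_{n,s}$ equals $s-n$ (in particular $F_{n,n}$ is a nonzero constant).
   Context: Convention: $0^0=1$. $P$-sequences are defined recursively: $\langle 1,-1\rangle$ is a $P$-sequence; if $\langle a_0,\dots,a_k\rangle$ is a $P$-sequence with $a_0=-a_k$, then $\langle a_0,\dots,a_k,a_k,\dots,a_0\rangle$ is a $P$-sequence; if $\langle a_0,\dots,a_k\rangle$ is a $P$-sequence with $a_0=a_k$, then $\langle a_0,\dots,a_{k-1},0,-a_{k-1},\dots,-a_0\rangle$ is a $P$-sequence; and only sequences obtained by finitely many applications of these clauses are $P$-sequences. Ordering the $P$-sequences by increasing length, $P_n$ denotes the $n$-th one; thus $P_1=\langle 1,-1\rangle$, $P_2=\langle 1,-1,-1,1\rangle$, $P_3=\langle 1,-1,-1,0,1,1,-1\rangle$, and each $P_{n+1}$ is obtained from $P_n$ by whichever of the two clauses applies. -}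

module Defs where

open import Data.Nat using (ℕ; zero; suc; _<_)
open import Data.Integer using (ℤ; +_; -_; _+_; _*_; 0ℤ; 1ℤ; _≟_)
open import Data.List using (List; []; _∷_; _++_; reverse; map; foldr; last; head)
open import Data.Maybe using (Maybe; just; nothing)
open import Relation.Nullary using (yes; no; ¬_)
open import Relation.Binary.PropositionalEquality using (_≡_)

init : List ℤ → List ℤ
init []           = []
init (x ∷ [])     = []
init (x ∷ y ∷ xs) = x ∷ init (y ∷ xs)

-- One application of whichever clause applies:
--  * a₀ = -a_k : ⟨a₀,…,a_k⟩ ↦ ⟨a₀,…,a_k,a_k,…,a₀⟩
--  * a₀ =  a_k : ⟨a₀,…,a_k⟩ ↦ ⟨a₀,…,a_{k-1},0,-a_{k-1},…,-a₀⟩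
-- (If neither applies the sequence is left unchanged; this never happens
--  along the chain P₁, P₂, … .)
stepWith : Maybe ℤ → Maybe ℤ → List ℤ → List ℤ
stepWith (just a₀) (just aₖ) l with a₀ ≟ - aₖ
... | yes _ = l ++ reverse l
... | no _ with a₀ ≟ aₖ
...   | yes _ = init l ++ (0ℤ ∷ map -_ (reverse (init l)))
...   | no _  = l
stepWith _ _ l = l

step : List ℤ → List ℤ
step l = stepWith (head l) (last l) l

-- P n is the n-th P-sequence P_n for n ≥ 1 (P 0 is an unused dummy).
P : ℕ → List ℤ
P zero          = []
P (suc zero)    = + 1 ∷ - (+ 1) ∷ []
P (suc (suc n)) = step (P (suc n))

-- Polynomials with integer coefficients as coefficient lists
-- (ascending powers: c₀ ∷ c₁ ∷ … represents c₀ + c₁ x + …).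

Poly : Set
Poly = List ℤ

padd : Poly → Poly → Poly
padd []       q        = q
padd p        []       = p
padd (a ∷ p)  (b ∷ q)  = (a + b) ∷ padd p q

pscale : ℤ → Poly → Poly
pscale c p = map (c *_) p

pmul : Poly → Poly → Poly
pmul []      q = []
pmul (a ∷ p) q = padd (pscale a q) (0ℤ ∷ pmul p q)

ppow : Poly → ℕ → Poly
ppow p zero    = 1ℤ ∷ []
ppow p (suc s) = pmul p (ppow p s)

linear : ℕ → Poly
linear i = + i ∷ 1ℤ ∷ []

Fsum : ℕ → List ℤ → ℕ → Poly
Fsum i []      s = []
Fsum i (a ∷ as) s = padd (pscale a (ppow (linear i) s)) (Fsum (suc i) as s)

F : ℕ → ℕ → Poly
F n s = Fsum 0 (P n) s

coeff : Poly → ℕ → ℤ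
coeff []      j       = 0ℤ
coeff (c ∷ p) zero    = c
coeff (c ∷ p) (suc j) = coeff p j

HasDegree : Poly → ℕ → Set
HasDegree p d = (¬ coeff p d ≡ 0ℤ) × (∀ j → d < j → coeff p j ≡ 0ℤ)
  where open import Data.Product using (_×_)

-- The coefficient of x^j in Σₖ aₖ (k + i + x)^s is (s C j) times the shifted
-- moment Σₖ aₖ (k + i)^(s ∸ j).  So it suffices that the moments of P_n of
-- order < n vanish at every shift i, while those of order n equal a common
-- nonzero constant c.  Every P-sequence starts with 1 and is palindromic or
-- antipalindromic, and either clause turns it into a sequence whose moments are
-- those of the old one minus those of the old one shifted by some e ≥ 1.  Once
-- the moments below order n vanish, the binomial theorem shows that shifting by
-- e adds e (n + 1) c to the moment of order n + 1, so the new sequence has order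
-- n + 1 with leading moment - e (n + 1) c ≠ 0.

module Submission where

open import Algebra.Bundles using (Semiring)
open import Data.Fin using (Fin; toℕ)
open import Data.Integer using (ℤ; +_; -_; _+_; _-_; _*_; _^_; 0ℤ; 1ℤ)
open import Data.Integer.Properties
  using ( +-*-semiring; *-commutativeSemigroup; +-comm; +-assoc; +-identityˡ; +-identityʳ
        ; +-inverseʳ; *-comm; *-identityˡ; *-zeroʳ; *-distribʳ-+; pos-+; +-injective
        ; neg-involutive; neg-injective; i*j≡0⇒i≡0∨j≡0 )
open import Data.Integer.Tactic.RingSolver using (solve-∀)
open import Data.List
  using (List; []; _∷_; _++_; _∷ʳ_; map; reverse; length; head; last; initLast; _∷ʳ′_)
open import Data.List.Properties
  using ( ∷-injectiveʳ; ++-assoc; map-++; map-∘; map-cong; map-id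
        ; reverse-++; reverse-involutive; reverse-map; unfold-reverse )
open import Data.Maybe using (just)
open import Data.Nat as ℕ using (ℕ; zero; suc; _≤_; _<_; _∸_; z≤n; s≤s)
import Data.Nat.Properties as ℕ
open import Data.Nat.Combinatorics
  using (_C_; nCn≡1; nC1≡n; nCk≡nC[n∸k]; k>n⇒nCk≡0; nCk+nC[k+1]≡[n+1]C[k+1])
open import Data.Product using (_,_; _×_; ∃-syntax)
open import Data.Sum using (inj₁; inj₂)
open import Relation.Nullary using (yes; no)
open import Relation.Binary.PropositionalEquality
open ≡-Reasoning

open import Algebra.Properties.CommutativeSemigroup *-commutativeSemigroup using (x∙yz≈y∙xz)
open import Algebra.Properties.Semiring.Sum +-*-semiring
  using (sum-syntax; sum⁺-syntax; sum-cong-≗; sum-replicate-zero; ∑-distrib-+; *-distribˡ-sum)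
import Algebra.Properties.Semiring.Binomial +-*-semiring as Binomial
open import Algebra.Definitions.RawSemiring (Semiring.rawSemiring +-*-semiring)
  using () renaming (_^_ to _^′_; _×_ to _×′_)

open import Defs

0<nCk : ∀ {n k} → k ≤ n → 0 < n C k
0<nCk {n}     {zero}  _         = s≤s z≤n
0<nCk {suc n} {suc k} (s≤s k≤n) =
  ℕ.<-≤-trans (0<nCk k≤n) (subst (n C k ≤_) (nCk+nC[k+1]≡[n+1]C[k+1] n k) (ℕ.m≤m+n _ _))

[n+1]Cn≡n+1 : ∀ n → suc n C n ≡ suc n
[n+1]Cn≡n+1 n = begin
  suc n C n           ≡⟨ nCk≡nC[n∸k] (ℕ.n≤1+n n) ⟩
  suc n C (suc n ∸ n) ≡⟨ cong (suc n C_) (ℕ.m+n∸n≡m 1 n) ⟩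
  suc n C 1           ≡⟨ nC1≡n (suc n) ⟩
  suc n               ∎

×′≡* : ∀ n x → n ×′ x ≡ + n * x
×′≡* zero    x = refl
×′≡* (suc n) x = begin
  x + n ×′ x        ≡⟨ cong₂ _+_ (sym (*-identityˡ x)) (×′≡* n x) ⟩
  1ℤ * x + + n * x  ≡⟨ *-distribʳ-+ x 1ℤ (+ n) ⟨
  + suc n * x       ∎

^′≡^ : ∀ x n → x ^′ n ≡ x ^ n
^′≡^ x zero    = refl
^′≡^ x (suc n) = cong (x *_) (^′≡^ x n)

binomial : ∀ x y t → (x + y) ^ t ≡ ∑[ k ≤ t ] (x ^ toℕ k * (+ (t C toℕ k) * y ^ (t ∸ toℕ k)))
binomial x y t = begin
  (x + y) ^ t   ≡⟨ ^′≡^ (x + y) t ⟨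
  (x + y) ^′ t  ≡⟨ Binomial.theorem x y (*-comm x y) t ⟩
  ∑[ k ≤ t ] ((t C toℕ k) ×′ (x ^′ toℕ k * y ^′ (t ∸ toℕ k)))
                ≡⟨ sum-cong-≗ {suc t} term ⟩
  ∑[ k ≤ t ] (x ^ toℕ k * (+ (t C toℕ k) * y ^ (t ∸ toℕ k))) ∎
  where
  term : ∀ k → (t C toℕ k) ×′ (x ^′ toℕ k * y ^′ (t ∸ toℕ k))
             ≡ x ^ toℕ k * (+ (t C toℕ k) * y ^ (t ∸ toℕ k))
  term k = begin
    (t C toℕ k) ×′ (x ^′ toℕ k * y ^′ (t ∸ toℕ k))
      ≡⟨ ×′≡* (t C toℕ k) _ ⟩
    + (t C toℕ k) * (x ^′ toℕ k * y ^′ (t ∸ toℕ k))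
      ≡⟨ cong₂ (λ a b → + (t C toℕ k) * (a * b)) (^′≡^ x (toℕ k)) (^′≡^ y (t ∸ toℕ k)) ⟩
    + (t C toℕ k) * (x ^ toℕ k * y ^ (t ∸ toℕ k))
      ≡⟨ x∙yz≈y∙xz (+ (t C toℕ k)) (x ^ toℕ k) _ ⟩
    x ^ toℕ k * (+ (t C toℕ k) * y ^ (t ∸ toℕ k)) ∎

*-≢0 : ∀ {i j} → i ≢ 0ℤ → j ≢ 0ℤ → i * j ≢ 0ℤ
*-≢0 {i} i≢0 j≢0 ij≡0 with i*j≡0⇒i≡0∨j≡0 i ij≡0
... | inj₁ i≡0 = i≢0 i≡0
... | inj₂ j≡0 = j≢0 j≡0

∑-vanishing-prefix : ∀ n m (f : ℕ → ℤ) → (∀ k → k < n → f k ≡ 0ℤ) →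
  ∑[ k < n ℕ.+ m ] f (toℕ k) ≡ ∑[ k < m ] f (n ℕ.+ toℕ k)
∑-vanishing-prefix zero    m f _      = refl
∑-vanishing-prefix (suc n) m f f<n≡0 = begin
  f 0 + ∑[ k < n ℕ.+ m ] f (suc (toℕ k))
    ≡⟨ cong (_+ ∑[ k < n ℕ.+ m ] f (suc (toℕ k))) (f<n≡0 0 (s≤s z≤n)) ⟩
  0ℤ + ∑[ k < n ℕ.+ m ] f (suc (toℕ k))
    ≡⟨ +-identityˡ _ ⟩
  ∑[ k < n ℕ.+ m ] f (suc (toℕ k))
    ≡⟨ ∑-vanishing-prefix n m (λ k → f (suc k)) (λ k k<n → f<n≡0 (suc k) (s≤s k<n)) ⟩
  ∑[ k < m ] f (suc n ℕ.+ toℕ k) ∎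

coeff-padd : ∀ p q j → coeff (padd p q) j ≡ coeff p j + coeff q j
coeff-padd []      q       j       = sym (+-identityˡ _)
coeff-padd (a ∷ p) []      j       = sym (+-identityʳ _)
coeff-padd (a ∷ p) (b ∷ q) zero    = refl
coeff-padd (a ∷ p) (b ∷ q) (suc j) = coeff-padd p q j

coeff-pscale : ∀ c p j → coeff (pscale c p) j ≡ c * coeff p j
coeff-pscale c []      j       = sym (*-zeroʳ c)
coeff-pscale c (a ∷ p) zero    = refl
coeff-pscale c (a ∷ p) (suc j) = coeff-pscale c p j

coeff-0∷[] : ∀ j → coeff (0ℤ ∷ []) j ≡ 0ℤ
coeff-0∷[] zero    = refl
coeff-0∷[] (suc j) = refl

coeff-pmul-1 : ∀ q j → coeff (pmul (1ℤ ∷ []) q) j ≡ coeff q j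
coeff-pmul-1 q j = begin
  coeff (padd (pscale 1ℤ q) (0ℤ ∷ [])) j
    ≡⟨ coeff-padd (pscale 1ℤ q) (0ℤ ∷ []) j ⟩
  coeff (pscale 1ℤ q) j + coeff (0ℤ ∷ []) j
    ≡⟨ cong₂ _+_ (coeff-pscale 1ℤ q j) (coeff-0∷[] j) ⟩
  1ℤ * coeff q j + 0ℤ
    ≡⟨ +-identityʳ _ ⟩
  1ℤ * coeff q j
    ≡⟨ *-identityˡ _ ⟩
  coeff q j ∎

coeff-pmul-linear : ∀ i q j → coeff (pmul (linear i) q) j ≡ + i * coeff q j + coeff (0ℤ ∷ q) j
coeff-pmul-linear i q j = begin
  coeff (pmul (linear i) q) j
    ≡⟨ coeff-padd (pscale (+ i) q) _ j ⟩
  coeff (pscale (+ i) q) j + coeff (0ℤ ∷ pmul (1ℤ ∷ []) q) j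
    ≡⟨ cong₂ _+_ (coeff-pscale (+ i) q j) (shift j) ⟩
  + i * coeff q j + coeff (0ℤ ∷ q) j ∎
  where
  shift : ∀ j → coeff (0ℤ ∷ pmul (1ℤ ∷ []) q) j ≡ coeff (0ℤ ∷ q) j
  shift zero    = refl
  shift (suc j) = coeff-pmul-1 q j

-- For k ≥ s the two exponents coincide (truncated subtraction), but then s C suc k = 0.
raise-exponent : ∀ x s k → x * (+ (s C suc k) * x ^ (s ∸ suc k)) ≡ + (s C suc k) * x ^ (s ∸ k)
raise-exponent x s k with k ℕ.<? s
... | yes k<s rewrite ℕ.+-∸-assoc 1 k<s = x∙yz≈y∙xz x (+ (s C suc k)) _
... | no  k≮s rewrite k>n⇒nCk≡0 (s≤s (ℕ.≮⇒≥ k≮s)) = *-zeroʳ x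

coeff-ppow-linear : ∀ i s j → coeff (ppow (linear i) s) j ≡ + (s C j) * (+ i) ^ (s ∸ j)
coeff-ppow-linear i zero    zero    = refl
coeff-ppow-linear i zero    (suc j) = refl
coeff-ppow-linear i (suc s) zero    = begin
  coeff (ppow (linear i) (suc s)) 0      ≡⟨ coeff-pmul-linear i (ppow (linear i) s) 0 ⟩
  + i * coeff (ppow (linear i) s) 0 + 0ℤ ≡⟨ +-identityʳ _ ⟩
  + i * coeff (ppow (linear i) s) 0      ≡⟨ cong (+ i *_) (coeff-ppow-linear i s 0) ⟩
  + i * (1ℤ * (+ i) ^ s)                 ≡⟨ cong (+ i *_) (*-identityˡ _) ⟩
  + i * (+ i) ^ s                        ≡⟨ *-identityˡ _ ⟨
  1ℤ * (+ i * (+ i) ^ s)                 ∎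
coeff-ppow-linear i (suc s) (suc j) = begin
  coeff (ppow (linear i) (suc s)) (suc j)
    ≡⟨ coeff-pmul-linear i (ppow (linear i) s) (suc j) ⟩
  + i * coeff (ppow (linear i) s) (suc j) + coeff (ppow (linear i) s) j
    ≡⟨ cong₂ (λ a b → + i * a + b) (coeff-ppow-linear i s (suc j)) (coeff-ppow-linear i s j) ⟩
  + i * (+ (s C suc j) * (+ i) ^ (s ∸ suc j)) + + (s C j) * (+ i) ^ (s ∸ j)
    ≡⟨ cong (_+ + (s C j) * (+ i) ^ (s ∸ j)) (raise-exponent (+ i) s j) ⟩
  + (s C suc j) * (+ i) ^ (s ∸ j) + + (s C j) * (+ i) ^ (s ∸ j)
    ≡⟨ *-distribʳ-+ ((+ i) ^ (s ∸ j)) (+ (s C suc j)) (+ (s C j)) ⟨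
  (+ (s C suc j) + + (s C j)) * (+ i) ^ (s ∸ j)
    ≡⟨ cong (λ c → c * (+ i) ^ (s ∸ j)) pascal ⟩
  + (suc s C suc j) * (+ i) ^ (s ∸ j) ∎
  where
  pascal : + (s C suc j) + + (s C j) ≡ + (suc s C suc j)
  pascal = begin
    + (s C suc j) + + (s C j)     ≡⟨ pos-+ (s C suc j) (s C j) ⟨
    + (s C suc j ℕ.+ s C j)       ≡⟨ cong +_ (ℕ.+-comm (s C suc j) (s C j)) ⟩
    + (s C j ℕ.+ s C suc j)       ≡⟨ cong +_ (nCk+nC[k+1]≡[n+1]C[k+1] s j) ⟩
    + (suc s C suc j)             ∎

moment : ℕ → List ℤ → ℕ → ℤ
moment i []       t = 0ℤ
moment i (a ∷ as) t = a * (+ i) ^ t + moment (suc i) as t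

moment-++ : ∀ i xs ys t → moment i (xs ++ ys) t ≡ moment i xs t + moment (length xs ℕ.+ i) ys t
moment-++ i []       ys t = sym (+-identityˡ _)
moment-++ i (x ∷ xs) ys t = begin
  x * (+ i) ^ t + moment (suc i) (xs ++ ys) t
    ≡⟨ cong (λ m → x * (+ i) ^ t + m) (moment-++ (suc i) xs ys t) ⟩
  x * (+ i) ^ t + (moment (suc i) xs t + moment (length xs ℕ.+ suc i) ys t)
    ≡⟨ +-assoc (x * (+ i) ^ t) _ _ ⟨
  moment i (x ∷ xs) t + moment (length xs ℕ.+ suc i) ys t
    ≡⟨ cong (λ j → moment i (x ∷ xs) t + moment j ys t) (ℕ.+-suc (length xs) i) ⟩
  moment i (x ∷ xs) t + moment (suc (length xs) ℕ.+ i) ys t ∎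

moment-neg : ∀ i xs t → moment i (map -_ xs) t ≡ - moment i xs t
moment-neg i []       t = refl
moment-neg i (x ∷ xs) t = begin
  - x * (+ i) ^ t + moment (suc i) (map -_ xs) t
    ≡⟨ cong (λ m → - x * (+ i) ^ t + m) (moment-neg (suc i) xs t) ⟩
  - x * (+ i) ^ t + - moment (suc i) xs t
    ≡⟨ negate x ((+ i) ^ t) (moment (suc i) xs t) ⟩
  - (x * (+ i) ^ t + moment (suc i) xs t) ∎
  where
  negate : ∀ x p m → - x * p + - m ≡ - (x * p + m)
  negate = solve-∀

moment-fold : ∀ i xs a ys t →
  moment i (xs ++ 0ℤ ∷ map -_ ys) t ≡ moment i (xs ∷ʳ a) t - moment (length xs ℕ.+ i) (a ∷ ys) t
moment-fold i xs a ys t = begin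
  moment i (xs ++ 0ℤ ∷ map -_ ys) t
    ≡⟨ moment-++ i xs (0ℤ ∷ map -_ ys) t ⟩
  moment i xs t + (0ℤ + moment (suc k) (map -_ ys) t)
    ≡⟨ cong (λ m → moment i xs t + (0ℤ + m)) (moment-neg (suc k) ys t) ⟩
  moment i xs t + (0ℤ + - moment (suc k) ys t)
    ≡⟨ rearrange (moment i xs t) (a * (+ k) ^ t) (moment (suc k) ys t) ⟩
  (moment i xs t + (a * (+ k) ^ t + 0ℤ)) - (a * (+ k) ^ t + moment (suc k) ys t)
    ≡⟨ cong (_- moment k (a ∷ ys) t) (moment-++ i xs (a ∷ []) t) ⟨
  moment i (xs ∷ʳ a) t - moment k (a ∷ ys) t ∎
  where
  k = length xs ℕ.+ i
  rearrange : ∀ x p m → x + (0ℤ + - m) ≡ (x + (p + 0ℤ)) - (p + m)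
  rearrange = solve-∀

moment-shift : ∀ e i l t →
  moment (e ℕ.+ i) l t ≡ ∑[ k ≤ t ] (moment i l (toℕ k) * (+ (t C toℕ k) * (+ e) ^ (t ∸ toℕ k)))
moment-shift e i []       t = sym (sum-replicate-zero (suc t))
moment-shift e i (a ∷ as) t = begin
  a * (+ (e ℕ.+ i)) ^ t + moment (suc (e ℕ.+ i)) as t
    ≡⟨ cong₂ (λ x j → a * x ^ t + moment j as t) +[e+i]≡+i++e (sym (ℕ.+-suc e i)) ⟩
  a * (+ i + + e) ^ t + moment (e ℕ.+ suc i) as t
    ≡⟨ cong₂ (λ x y → a * x + y) (binomial (+ i) (+ e) t) (moment-shift e (suc i) as t) ⟩
  a * ∑[ k ≤ t ] (p k * w k) + ∑[ k ≤ t ] (q k * w k)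
    ≡⟨ cong (_+ ∑[ k ≤ t ] (q k * w k)) (*-distribˡ-sum {suc t} a (λ k → p k * w k)) ⟩
  ∑[ k ≤ t ] (a * (p k * w k)) + ∑[ k ≤ t ] (q k * w k)
    ≡⟨ ∑-distrib-+ {suc t} (λ k → a * (p k * w k)) (λ k → q k * w k) ⟨
  ∑[ k ≤ t ] (a * (p k * w k) + q k * w k)
    ≡⟨ sum-cong-≗ {suc t} (λ k → factor a (p k) (q k) (w k)) ⟩
  ∑[ k ≤ t ] ((a * p k + q k) * w k) ∎
  where
  p q w : Fin (suc t) → ℤ
  p k = (+ i) ^ toℕ k
  q k = moment (suc i) as (toℕ k)
  w k = + (t C toℕ k) * (+ e) ^ (t ∸ toℕ k)
  +[e+i]≡+i++e : + (e ℕ.+ i) ≡ + i + + e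
  +[e+i]≡+i++e = trans (pos-+ e i) (+-comm (+ e) (+ i))
  factor : ∀ a p q w → a * (p * w) + q * w ≡ (a * p + q) * w
  factor = solve-∀

coeff-Fsum : ∀ i l s j → coeff (Fsum i l s) j ≡ + (s C j) * moment i l (s ∸ j)
coeff-Fsum i []       s j = sym (*-zeroʳ (+ (s C j)))
coeff-Fsum i (a ∷ as) s j = begin
  coeff (Fsum i (a ∷ as) s) j
    ≡⟨ coeff-padd (pscale a (ppow (linear i) s)) (Fsum (suc i) as s) j ⟩
  coeff (pscale a (ppow (linear i) s)) j + coeff (Fsum (suc i) as s) j
    ≡⟨ cong (_+ coeff (Fsum (suc i) as s) j) (coeff-pscale a (ppow (linear i) s) j) ⟩
  a * coeff (ppow (linear i) s) j + coeff (Fsum (suc i) as s) j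
    ≡⟨ cong₂ (λ x y → a * x + y) (coeff-ppow-linear i s j) (coeff-Fsum (suc i) as s j) ⟩
  a * (+ (s C j) * (+ i) ^ (s ∸ j)) + + (s C j) * moment (suc i) as (s ∸ j)
    ≡⟨ factor a (+ (s C j)) ((+ i) ^ (s ∸ j)) (moment (suc i) as (s ∸ j)) ⟩
  + (s C j) * moment i (a ∷ as) (s ∸ j) ∎
  where
  factor : ∀ a b p m → a * (b * p) + b * m ≡ b * (a * p + m)
  factor = solve-∀

record HasOrder (n : ℕ) (c : ℤ) (l : List ℤ) : Set where
  field
    vanishes : ∀ i k → k < n → moment i l k ≡ 0ℤ
    leading  : ∀ i → moment i l n ≡ c

open HasOrder

moment-shift-affine : ∀ {n c l} → HasOrder n c l → ∀ e i →
  moment (e ℕ.+ i) l (suc n) ≡ moment i l (suc n) + + e * (+ suc n * c)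
moment-shift-affine {n} {c} {l} ord e i = begin
  moment (e ℕ.+ i) l (suc n)
    ≡⟨ moment-shift e i l (suc n) ⟩
  ∑[ k < 2 ℕ.+ n ] f (toℕ k)
    ≡⟨ cong (λ m → ∑[ k < m ] f (toℕ k)) (ℕ.+-comm 2 n) ⟩
  ∑[ k < n ℕ.+ 2 ] f (toℕ k)
    ≡⟨ ∑-vanishing-prefix n 2 f (λ k k<n → cong (_* w k) (vanishes ord i k k<n)) ⟩
  f (n ℕ.+ 0) + (f (n ℕ.+ 1) + 0ℤ)
    ≡⟨ cong₂ (λ a b → f a + (f b + 0ℤ)) (ℕ.+-identityʳ n) (ℕ.+-comm n 1) ⟩
  f n + (f (suc n) + 0ℤ)
    ≡⟨ cong₂ (λ a b → a + (b + 0ℤ)) f-n f-[n+1] ⟩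
  c * (+ suc n * (+ e * 1ℤ)) + (moment i l (suc n) * 1ℤ + 0ℤ)
    ≡⟨ collect c (+ suc n) (+ e) (moment i l (suc n)) ⟩
  moment i l (suc n) + + e * (+ suc n * c) ∎
  where
  w : ℕ → ℤ
  w k = + (suc n C k) * (+ e) ^ (suc n ∸ k)
  f : ℕ → ℤ
  f k = moment i l k * w k
  f-n : f n ≡ c * (+ suc n * (+ e * 1ℤ))
  f-n rewrite leading ord i | [n+1]Cn≡n+1 n | ℕ.m+n∸n≡m 1 n = refl
  f-[n+1] : f (suc n) ≡ moment i l (suc n) * 1ℤ
  f-[n+1] rewrite nCn≡1 (suc n) | ℕ.n∸n≡0 n = refl
  collect : ∀ c N E M → c * (N * (E * 1ℤ)) + (M * 1ℤ + 0ℤ) ≡ M + E * (N * c)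
  collect = solve-∀

difference-raises-order : ∀ {n c l l′} e → HasOrder n c l →
  (∀ i t → moment i l′ t ≡ moment i l t - moment (e ℕ.+ i) l t) →
  HasOrder (suc n) (- (+ e * (+ suc n * c))) l′
difference-raises-order {n} {c} {l} {l′} e ord l′≡Δl =
  record { vanishes = vanishes′ ; leading = leading′ }
  where
  vanishes′ : ∀ i k → k < suc n → moment i l′ k ≡ 0ℤ
  vanishes′ i k (s≤s k≤n) with ℕ.m≤n⇒m<n∨m≡n k≤n
  ... | inj₁ k<n  rewrite l′≡Δl i k | vanishes ord i k k<n | vanishes ord (e ℕ.+ i) k k<n = refl
  ... | inj₂ refl rewrite l′≡Δl i k | leading ord i | leading ord (e ℕ.+ i) = +-inverseʳ c
  leading′ : ∀ i → moment i l′ (suc n) ≡ - (+ e * (+ suc n * c))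
  leading′ i rewrite l′≡Δl i (suc n) | moment-shift-affine ord e i = cancel (moment i l (suc n)) _
    where
    cancel : ∀ m x → m - (m + x) ≡ - x
    cancel = solve-∀

HasOrder⇒HasDegree : ∀ {n c l} i s → HasOrder n c l → c ≢ 0ℤ → n ≤ s →
  HasDegree (Fsum i l s) (s ∸ n)
HasOrder⇒HasDegree {n} {c} {l} i s ord c≢0 n≤s = leading-coeff≢0 , coeff-above≡0
  where
  leading-coeff : coeff (Fsum i l s) (s ∸ n) ≡ + (s C (s ∸ n)) * c
  leading-coeff = begin
    coeff (Fsum i l s) (s ∸ n)
      ≡⟨ coeff-Fsum i l s (s ∸ n) ⟩
    + (s C (s ∸ n)) * moment i l (s ∸ (s ∸ n))
      ≡⟨ cong (λ k → + (s C (s ∸ n)) * moment i l k) (ℕ.m∸[m∸n]≡n n≤s) ⟩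
    + (s C (s ∸ n)) * moment i l n
      ≡⟨ cong (+ (s C (s ∸ n)) *_) (leading ord i) ⟩
    + (s C (s ∸ n)) * c ∎
  C≢0 : + (s C (s ∸ n)) ≢ 0ℤ
  C≢0 C≡0 = ℕ.<⇒≢ (0<nCk (ℕ.m∸n≤m s n)) (sym (+-injective C≡0))
  leading-coeff≢0 : coeff (Fsum i l s) (s ∸ n) ≢ 0ℤ
  leading-coeff≢0 eq = *-≢0 C≢0 c≢0 (trans (sym leading-coeff) eq)
  s∸j<n : ∀ {j} → s ∸ n < j → j ≤ s → s ∸ j < n
  s∸j<n {j} s∸n<j j≤s = subst (s ∸ j <_) (ℕ.m∸[m∸n]≡n n≤s) (ℕ.∸-monoʳ-< s∸n<j j≤s)
  coeff-above≡0 : ∀ j → s ∸ n < j → coeff (Fsum i l s) j ≡ 0ℤ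
  coeff-above≡0 j s∸n<j rewrite coeff-Fsum i l s j with j ℕ.≤? s
  ... | yes j≤s rewrite vanishes ord i (s ∸ j) (s∸j<n s∸n<j j≤s) = *-zeroʳ (+ (s C j))
  ... | no  j≰s rewrite k>n⇒nCk≡0 (ℕ.≰⇒> j≰s) = refl

Palindromic Antipalindromic : List ℤ → Set
Palindromic     l = reverse l ≡ l
Antipalindromic l = reverse l ≡ map -_ l

last-∷ʳ : ∀ {A : Set} (xs : List A) x → last (xs ∷ʳ x) ≡ just x
last-∷ʳ []           x = refl
last-∷ʳ (y ∷ [])     x = refl
last-∷ʳ (y ∷ z ∷ xs) x = last-∷ʳ (z ∷ xs) x

head-reverse : ∀ {A : Set} (xs : List A) → head (reverse xs) ≡ last xs
head-reverse xs with initLast xs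
... | []       = refl
... | ys ∷ʳ′ y = trans (cong head (reverse-++ ys (y ∷ []))) (sym (last-∷ʳ ys y))

init-last : ∀ {l z} → last l ≡ just z → l ≡ init l ∷ʳ z
init-last {x ∷ []}     refl = refl
init-last {x ∷ y ∷ ys} eq   = cong (x ∷_) (init-last {y ∷ ys} eq)

palindromic-++-reverse : ∀ xs → Palindromic (xs ++ reverse xs)
palindromic-++-reverse xs = begin
  reverse (xs ++ reverse xs)         ≡⟨ reverse-++ xs (reverse xs) ⟩
  reverse (reverse xs) ++ reverse xs ≡⟨ cong (_++ reverse xs) (reverse-involutive xs) ⟩
  xs ++ reverse xs                   ∎

antipalindromic-fold : ∀ xs → Antipalindromic (xs ++ 0ℤ ∷ map -_ (reverse xs))
antipalindromic-fold xs = begin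
  reverse (xs ++ 0ℤ ∷ map -_ (reverse xs))
    ≡⟨ reverse-++ xs (0ℤ ∷ map -_ (reverse xs)) ⟩
  reverse (0ℤ ∷ map -_ (reverse xs)) ++ reverse xs
    ≡⟨ cong (_++ reverse xs) (unfold-reverse 0ℤ (map -_ (reverse xs))) ⟩
  reverse (map -_ (reverse xs)) ∷ʳ 0ℤ ++ reverse xs
    ≡⟨ cong (λ ys → ys ∷ʳ 0ℤ ++ reverse xs) (reverse-map -_ (reverse xs)) ⟨
  map -_ (reverse (reverse xs)) ∷ʳ 0ℤ ++ reverse xs
    ≡⟨ cong (λ ys → map -_ ys ∷ʳ 0ℤ ++ reverse xs) (reverse-involutive xs) ⟩
  map -_ xs ∷ʳ 0ℤ ++ reverse xs
    ≡⟨ ++-assoc (map -_ xs) (0ℤ ∷ []) (reverse xs) ⟩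
  map -_ xs ++ 0ℤ ∷ reverse xs
    ≡⟨ cong (λ ys → map -_ xs ++ 0ℤ ∷ ys) (map-neg-involutive (reverse xs)) ⟨
  map -_ xs ++ 0ℤ ∷ map -_ (map -_ (reverse xs))
    ≡⟨ map-++ -_ xs (0ℤ ∷ map -_ (reverse xs)) ⟨
  map -_ (xs ++ 0ℤ ∷ map -_ (reverse xs)) ∎
  where
  map-neg-involutive : ∀ ys → map -_ (map -_ ys) ≡ ys
  map-neg-involutive ys = trans (sym (map-∘ ys)) (trans (map-cong neg-involutive ys) (map-id ys))

data Shape : List ℤ → Set where
  antipalindromic : ∀ {b m} → Antipalindromic (1ℤ ∷ b ∷ m) → Shape (1ℤ ∷ b ∷ m)
  palindromic     : ∀ {b m} → Palindromic (1ℤ ∷ b ∷ m) → Shape (1ℤ ∷ b ∷ m)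

step-antipalindromic : ∀ {m} → Antipalindromic (1ℤ ∷ m) →
  step (1ℤ ∷ m) ≡ (1ℤ ∷ m) ++ reverse (1ℤ ∷ m)
step-antipalindromic {m} anti = cong (λ z → stepWith (just 1ℤ) z (1ℤ ∷ m)) last≡-1
  where
  last≡-1 : last (1ℤ ∷ m) ≡ just (- 1ℤ)
  last≡-1 = trans (sym (head-reverse (1ℤ ∷ m))) (cong head anti)

last-palindromic : ∀ {m} → Palindromic (1ℤ ∷ m) → last (1ℤ ∷ m) ≡ just 1ℤ
last-palindromic {m} pal = trans (sym (head-reverse (1ℤ ∷ m))) (cong head pal)

step-palindromic : ∀ {m} → Palindromic (1ℤ ∷ m) →
  step (1ℤ ∷ m) ≡ init (1ℤ ∷ m) ++ 0ℤ ∷ map -_ (reverse (init (1ℤ ∷ m)))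
step-palindromic {m} pal = cong (λ z → stepWith (just 1ℤ) z (1ℤ ∷ m)) (last-palindromic pal)

step-shape : ∀ {l} → Shape l → Shape (step l)
step-shape (antipalindromic {b} {m} anti) =
  subst Shape (sym (step-antipalindromic anti)) (palindromic (palindromic-++-reverse (1ℤ ∷ b ∷ m)))
step-shape (palindromic {b} {m} pal) =
  subst Shape (sym (step-palindromic pal))
    (shape (init (b ∷ m)) (antipalindromic-fold (init (1ℤ ∷ b ∷ m))))
  where
  shape : ∀ xs {ys} → Antipalindromic (1ℤ ∷ xs ++ 0ℤ ∷ ys) → Shape (1ℤ ∷ xs ++ 0ℤ ∷ ys)
  shape []      = antipalindromic
  shape (_ ∷ _) = antipalindromic

step-moments : ∀ {l} → Shape l →
  ∃[ e ] ∀ i t → moment i (step l) t ≡ moment i l t - moment (suc e ℕ.+ i) l t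
step-moments (antipalindromic {b} {m} anti) = suc (length m) , λ i t → begin
  moment i (step l) t
    ≡⟨ cong (λ xs → moment i xs t) (step-antipalindromic anti) ⟩
  moment i (l ++ reverse l) t
    ≡⟨ moment-++ i l (reverse l) t ⟩
  moment i l t + moment (length l ℕ.+ i) (reverse l) t
    ≡⟨ cong (λ xs → moment i l t + moment (length l ℕ.+ i) xs t) anti ⟩
  moment i l t + moment (length l ℕ.+ i) (map -_ l) t
    ≡⟨ cong (λ x → moment i l t + x) (moment-neg (length l ℕ.+ i) l t) ⟩
  moment i l t - moment (length l ℕ.+ i) l t ∎
  where
  l = 1ℤ ∷ b ∷ m
step-moments (palindromic {b} {m} pal) = length (init (b ∷ m)) , λ i t → begin
  moment i (step l) t
    ≡⟨ cong (λ xs → moment i xs t) (step-palindromic pal) ⟩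
  moment i (r ++ 0ℤ ∷ map -_ (reverse r)) t
    ≡⟨ cong (λ xs → moment i (r ++ 0ℤ ∷ map -_ xs) t) reverse-r ⟩
  moment i (r ++ 0ℤ ∷ map -_ (b ∷ m)) t
    ≡⟨ moment-fold i r 1ℤ (b ∷ m) t ⟩
  moment i (r ∷ʳ 1ℤ) t - moment (length r ℕ.+ i) l t
    ≡⟨ cong (λ xs → moment i xs t - moment (length r ℕ.+ i) l t) l≡r∷ʳ1 ⟨
  moment i l t - moment (length r ℕ.+ i) l t ∎
  where
  l = 1ℤ ∷ b ∷ m
  r = init l
  l≡r∷ʳ1 : l ≡ r ∷ʳ 1ℤ
  l≡r∷ʳ1 = init-last (last-palindromic pal)
  reverse-r : reverse r ≡ b ∷ m
  reverse-r = ∷-injectiveʳ (begin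
    1ℤ ∷ reverse r    ≡⟨ reverse-++ r (1ℤ ∷ []) ⟨
    reverse (r ∷ʳ 1ℤ) ≡⟨ cong reverse l≡r∷ʳ1 ⟨
    reverse l         ≡⟨ pal ⟩
    l                 ∎)

P-shape : ∀ n → Shape (P (suc n))
P-shape zero    = antipalindromic refl
P-shape (suc n) = step-shape (P-shape n)

P₁-order : HasOrder 1 (- 1ℤ) (P 1)
P₁-order = record { vanishes = vanishes′ ; leading = λ i → cancel (+ i) }
  where
  vanishes′ : ∀ i k → k < 1 → moment i (P 1) k ≡ 0ℤ
  vanishes′ i zero    _         = refl
  vanishes′ i (suc k) (s≤s ())
  cancel : ∀ x → 1ℤ * (x * 1ℤ) + (- 1ℤ * ((1ℤ + x) * 1ℤ) + 0ℤ) ≡ - 1ℤ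
  cancel = solve-∀

P-order : ∀ n → ∃[ c ] c ≢ 0ℤ × HasOrder (suc n) c (P (suc n))
P-order zero    = - 1ℤ , (λ ()) , P₁-order
P-order (suc n) with P-order n | step-moments (P-shape n)
... | c , c≢0 , ord | e , Δ = _ , c′≢0 , difference-raises-order (suc e) ord Δ
  where
  c′≢0 : - (+ suc e * (+ suc (suc n) * c)) ≢ 0ℤ
  c′≢0 eq = *-≢0 {+ suc e} (λ ()) (*-≢0 {+ suc (suc n)} (λ ()) c≢0) (neg-injective eq)

theorem1 : ∀ (n s : ℕ) → 1 ≤ n → n ≤ s → HasDegree (F n s) (s ∸ n)
theorem1 zero    s () _
theorem1 (suc n) s _ n≤s with P-order n
... | c , c≢0 , ord = HasOrder⇒HasDegree 0 s ord c≢0 n≤s
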